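{- For every integer $n\ge 2$ with $n\ne 3$, $i_b(P_n)=\left\lceil\frac{2n}{5}\right\rceil$, where $P_n$ is the path of order $n$.
   Context: For a graph $G=(V,E)$, a broadcast is a function $f:V\to\{0,\dots,\operatorname{diam}(G)\}$ with $f(v)\le e_G(v)$ (eccentricity) for all $v$. Let $V^+_f=\{v: f(v)>0\}$ and $H_f(u)=\{v\in V^+_f: d_G(u,v)\le f(v)\}$. The cost is $\sigma(f)=\sum_v f(v)$. $f$ is independent if $|H_f(v)|=1$ for every $v\in V^+_f$. An independent broadcast $f$ is maximal if no independent broadcast $g\ne f$ satisfies $g\ge f$ pointwise. $i_b(G)$ is the minimum cost of a maximal independent broadcast on $G$. -}

module Defs where

open import Data.Nat using (ℕ; zero; suc; _+_; _*_; _≤_; _<_; _⊔_; _/_)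
open import Data.Fin using (Fin; toℕ)
open import Data.List using (List; map; foldr; allFin)
open import Data.Nat.ListAction using (sum)
open import Data.Product using (Σ; _×_; _,_)
open import Relation.Binary.PropositionalEquality using (_≡_)

absDiff : ℕ → ℕ → ℕ
absDiff zero    n       = n
absDiff (suc m) zero    = suc m
absDiff (suc m) (suc n) = absDiff m n

-- A finite connected graph is represented here by its vertex set Fin n
-- together with its distance function d_G.
Dist : ℕ → Set
Dist n = Fin n → Fin n → ℕ

-- The path P_n of order n: vertices 0,…,n-1, i adjacent to i+1;
-- its distance is d(i,j) = |i - j|.
pathDist : (n : ℕ) → Dist n
pathDist n i j = absDiff (toℕ i) (toℕ j)

ecc : {n : ℕ} → Dist n → Fin n → ℕ
ecc {n} d v = foldr _⊔_ 0 (map (d v) (allFin n))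

diam : {n : ℕ} → Dist n → ℕ
diam {n} d = foldr _⊔_ 0 (map (ecc d) (allFin n))

IsBroadcast : {n : ℕ} → Dist n → (Fin n → ℕ) → Set
IsBroadcast d f = ∀ v → (f v ≤ diam d) × (f v ≤ ecc d v)

InH : {n : ℕ} → Dist n → (Fin n → ℕ) → Fin n → Fin n → Set
InH d f u v = (0 < f v) × (d u v ≤ f v)

cost : {n : ℕ} → (Fin n → ℕ) → ℕ
cost {n} f = sum (map f (allFin n))

-- independent: |H_f(v)| = 1 for all v ∈ V⁺_f.  Since v ∈ H_f(v) always
-- holds for v ∈ V⁺_f (d(v,v) = 0), this says H_f(v) = {v}.
IsIndependent : {n : ℕ} → Dist n → (Fin n → ℕ) → Set
IsIndependent d f = ∀ v → 0 < f v → ∀ w → InH d f v w → w ≡ v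

IsIndepBroadcast : {n : ℕ} → Dist n → (Fin n → ℕ) → Set
IsIndepBroadcast d f = IsBroadcast d f × IsIndependent d f

IsMaximalIndepBroadcast : {n : ℕ} → Dist n → (Fin n → ℕ) → Set
IsMaximalIndepBroadcast d f =
  IsIndepBroadcast d f ×
  (∀ g → IsIndepBroadcast d g → (∀ v → f v ≤ g v) → ∀ v → g v ≡ f v)

IbEq : {n : ℕ} → Dist n → ℕ → Set
IbEq d k =
  Σ _ (λ f → IsMaximalIndepBroadcast d f × cost f ≡ k) ×
  (∀ f → IsMaximalIndepBroadcast d f → k ≤ cost f)

ceil2n/5 : ℕ → ℕ
ceil2n/5 n = (2 * n + 4) / 5

module Submission where

-- A broadcast on a graph is maximal independent iff it is independent, dominating (every vertex hears
-- a broadcaster) and saturated (raising any single value f v by one breaks independence or exceeds the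
-- eccentricity of v); on the path these become conditions on positions in ℕ.
--
-- Lower bound. Scan the broadcasters from left to right. Writing S v for the total power of the
-- broadcasters up to v, induction shows 2 (v + f v + 1) ≤ 5 S v + 1, and even ≤ 5 S v when v and an
-- earlier broadcaster u are at distance f u + 1 or f v + 1 (a tight gap). Domination bounds the gap
-- between consecutive broadcasters by f u + f v + 1, and saturation of u forces a non-tight gap to be
-- preceded by a tight one, which pays for the slack. At the last broadcaster, saturation again yields
-- either a tight gap or a single broadcaster covering the whole path, so 2n ≤ 5 σ(f), except for
-- n = 3 with the single broadcast of power 1 at the middle vertex.
--
-- Upper bound. For n = 5q + m with 4 ≤ m ≤ 8, power 1 on the pattern (01010)^q 0101… (m letters in
-- the tail) is maximal independent of cost 2q + ⌊m/2⌋ = ⌈2n/5⌉; for n = 2 power 1 at an end vertex.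

open import Data.Fin as Fin using (Fin; toℕ)
open import Data.Fin.Properties using (any?; all?; ¬∀⟶∃¬; toℕ<n; toℕ-fromℕ<; toℕ-injective)
open import Data.List using ([]; _∷_; map; foldr; allFin; tabulate)
open import Data.List.Membership.Propositional.Properties using (∈-allFin)
open import Data.List.Properties using (foldr-preservesᵇ; foldr-preservesᵒ; map-tabulate)
import Data.List.Relation.Unary.All as All
import Data.List.Relation.Unary.All.Properties as All
import Data.List.Relation.Unary.Any as Any
import Data.List.Relation.Unary.Any.Properties as Any
open import Data.Nat using (ℕ; zero; suc; pred; _+_; _*_; _∸_; _/_; _≤_; _<_; _⊔_; z≤n; s≤s; s≤s⁻¹; _≤?_; _<?_; ∣_-_∣)
open import Data.Nat.Divisibility using (divides-refl)
open import Data.Nat.DivMod using (m<n*o⇒m/o<n; +-distrib-/-∣ʳ; m*n/n≡m)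
open import Data.Nat.Induction using (<-rec)
open import Data.Nat.ListAction using (sum)
open import Data.Nat.Properties
open import Data.Nat.Tactic.RingSolver using (solve)
open import Data.Product using (Σ-syntax; ∃-syntax; _×_; _,_; proj₁; proj₂)
open import Data.Sum using (_⊎_; inj₁; inj₂; [_,_])
open import Data.Vec.Functional using (updateAt)
open import Data.Vec.Functional.Properties using (updateAt-updates; updateAt-minimal)
open import Function using (_∘_)
open import Relation.Binary using (tri<; tri≈; tri>)
open import Relation.Binary.PropositionalEquality
  using (_≡_; _≢_; refl; sym; trans; cong; cong₂; subst; subst₂; module ≡-Reasoning)
open import Relation.Nullary using (¬_; yes; no; contradiction)
open import Relation.Nullary.Decidable using (_×-dec_)

open import Defs

-- Maximal independent broadcasts on a graph

Dominating : {n : ℕ} → Dist n → (Fin n → ℕ) → Set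
Dominating d f = ∀ u → ∃[ v ] InH d f u v

Saturated : {n : ℕ} → Dist n → (Fin n → ℕ) → Set
Saturated d f = ∀ v → 0 < f v → (∀ w → d v w ≤ f v) ⊎ ∃[ w ] 0 < f w × d v w ≡ suc (f v)

≤-foldr-⊔ : ∀ {n} (h : Fin n → ℕ) i → h i ≤ foldr _⊔_ 0 (map h (allFin n))
≤-foldr-⊔ h i = foldr-preservesᵒ {P = h i ≤_} (λ a b → [ m≤n⇒m≤n⊔o b , m≤n⇒m≤o⊔n a ]) 0 _
  (inj₂ (Any.map⁺ (Any.map (λ { refl → ≤-refl }) (∈-allFin i))))

foldr-⊔-least : ∀ {n} (h : Fin n → ℕ) {b} → (∀ i → h i ≤ b) → foldr _⊔_ 0 (map h (allFin n)) ≤ b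
foldr-⊔-least h {b} h≤b =
  foldr-preservesᵇ {P = _≤ b} {f = _⊔_} ⊔-lub z≤n (All.map⁺ (All.tabulate {xs = allFin _} (λ {i} _ → h≤b i)))

module _ {n : ℕ} (d : Dist n) where

  ≤-ecc : ∀ v w → d v w ≤ ecc d v
  ≤-ecc v = ≤-foldr-⊔ (d v)

  ecc-≤-diam : ∀ v → ecc d v ≤ diam d
  ecc-≤-diam = ≤-foldr-⊔ (ecc d)

  ecc-least : ∀ {v k} → (∀ w → d v w ≤ k) → ecc d v ≤ k
  ecc-least = foldr-⊔-least (d _)

  isBroadcast-reaching : ∀ {f} → (∀ v → ∃[ w ] f v ≤ d v w) → IsBroadcast d f
  isBroadcast-reaching reach v = let w , fv≤ = reach v; fv≤ecc = ≤-trans fv≤ (≤-ecc v w) in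
    ≤-trans fv≤ecc (ecc-≤-diam v) , fv≤ecc

  raise : Fin n → (Fin n → ℕ) → Fin n → ℕ
  raise x f = updateAt f x suc

  raise-self : ∀ x f → raise x f x ≡ suc (f x)
  raise-self x f = updateAt-updates x f

  raise-other : ∀ {x v} f → v ≢ x → raise x f v ≡ f v
  raise-other f v≢x = updateAt-minimal _ _ f v≢x

  raise-≥ : ∀ x f v → f v ≤ raise x f v
  raise-≥ x f v with v Fin.≟ x
  ... | yes refl = ≤-trans (n≤1+n (f x)) (≤-reflexive (sym (raise-self x f)))
  ... | no v≢x   = ≤-reflexive (sym (raise-other f v≢x))

  raise-isBroadcast : ∀ {x f w} → IsBroadcast d f → suc (f x) ≤ d x w → IsBroadcast d (raise x f)
  raise-isBroadcast {x} {f} {w} bf far v with v Fin.≟ x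
  ... | yes refl rewrite raise-self x f = ≤-trans fx≤ecc (ecc-≤-diam x) , fx≤ecc
    where fx≤ecc = ≤-trans far (≤-ecc x w)
  ... | no v≢x rewrite raise-other f v≢x = bf v

  raise-isIndependent : ∀ {x f} → IsIndependent d f →
    (∀ a → a ≢ x → 0 < f a → f a < d x a × suc (f x) < d a x) → IsIndependent d (raise x f)
  raise-isIndependent {x} {f} indep apart v gv>0 w (gw>0 , dvw≤gw) with w Fin.≟ x | v Fin.≟ x
  ... | yes refl | yes refl = refl
  ... | yes refl | no v≢x =
    contradiction (subst (d v x ≤_) (raise-self x f) dvw≤gw)
                  (<⇒≱ (proj₂ (apart v v≢x (subst (0 <_) (raise-other f v≢x) gv>0))))
  ... | no w≢x | yes refl =
    contradiction (subst (d x w ≤_) (raise-other f w≢x) dvw≤gw)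
                  (<⇒≱ (proj₁ (apart w w≢x (subst (0 <_) (raise-other f w≢x) gw>0))))
  ... | no w≢x | no v≢x =
    indep v (subst (0 <_) (raise-other f v≢x) gv>0) w
      (subst (0 <_) (raise-other f w≢x) gw>0 , subst (d v w ≤_) (raise-other f w≢x) dvw≤gw)

  maximal-unraisable : ∀ {f} x → IsMaximalIndepBroadcast d f → ¬ IsIndepBroadcast d (raise x f)
  maximal-unraisable {f} x (_ , maximal) raisedIB =
    1+n≢n (trans (sym (raise-self x f)) (maximal _ raisedIB (raise-≥ x f) x))

  module _ (d-refl : ∀ v → d v v ≡ 0) (d-sym : ∀ v w → d v w ≡ d w v) where

    maximal⇒dominating : ∀ {f} → (∀ v → ∃[ w ] 0 < d v w) → IsMaximalIndepBroadcast d f → Dominating d f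
    maximal⇒dominating {f} far M@((fB , fI) , _) u with any? (λ v → (0 <? f v) ×-dec (d u v ≤? f v))
    ... | yes heard = heard
    ... | no unheard =
      contradiction (raise-isBroadcast fB (subst (λ k → suc k ≤ d u w) (sym fu≡0) 0<duw) , raise-isIndependent fI apart)
                    (maximal-unraisable u M)
      where
      w = proj₁ (far u)
      0<duw = proj₂ (far u)
      fu≡0 : f u ≡ 0
      fu≡0 = n≤0⇒n≡0 (≮⇒≥ (λ fu>0 → unheard (u , fu>0 , subst (_≤ f u) (sym (d-refl u)) z≤n)))
      apart : ∀ a → a ≢ u → 0 < f a → f a < d u a × suc (f u) < d a u
      apart a _ fa>0 = fa<dua , subst₂ _<_ (cong suc (sym fu≡0)) (d-sym u a) (≤-<-trans fa>0 fa<dua)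
        where fa<dua = ≰⇒> (λ le → unheard (a , fa>0 , le))

    maximal⇒saturated : ∀ {f} → IsMaximalIndepBroadcast d f → Saturated d f
    maximal⇒saturated {f} M@((fB , fI) , _) v fv>0
      with any? (λ w → (0 <? f w) ×-dec (d v w ≟ suc (f v)))
    ... | yes blocker = inj₂ blocker
    ... | no noBlocker with all? (λ w → d v w ≤? f v)
    ...   | yes covers = inj₁ covers
    ...   | no ¬covers =
      contradiction (raise-isBroadcast fB (≰⇒> (proj₂ outside)) , raise-isIndependent fI apart)
                    (maximal-unraisable v M)
      where
      outside = ¬∀⟶∃¬ _ _ (λ w → d v w ≤? f v) ¬covers
      apart : ∀ a → a ≢ v → 0 < f a → f a < d v a × suc (f v) < d a v
      apart a a≢v fa>0 = ≰⇒> (λ le → a≢v (fI v fv>0 a (fa>0 , le))) , ≤∧≢⇒< fv<dav dav≢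
        where
        fv<dav = ≰⇒> (λ le → a≢v (sym (fI a fa>0 v (fv>0 , le))))
        dav≢ : suc (f v) ≢ d a v
        dav≢ e = noBlocker (a , fa>0 , trans (d-sym v a) (sym e))

    saturated⇒maximal : ∀ {f} → IsIndepBroadcast d f → Dominating d f → Saturated d f →
                        IsMaximalIndepBroadcast d f
    saturated⇒maximal {f} fIB dom sat = fIB , maximality
      where
      maximality : ∀ g → IsIndepBroadcast d g → (∀ v → f v ≤ g v) → ∀ v → g v ≡ f v
      maximality g (gB , gI) f≤g v with m≤n⇒m<n∨m≡n (f≤g v)
      ... | inj₂ fv≡gv = sym fv≡gv
      ... | inj₁ fv<gv with dom v
      ...   | u , fu>0 , dvu≤fu with gI v gv>0 u (≤-trans fu>0 (f≤g u) , ≤-trans dvu≤fu (f≤g u))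
        where gv>0 = ≤-<-trans z≤n fv<gv
      ...     | refl with sat v fu>0
      ...       | inj₁ covers = contradiction (≤-trans (proj₂ (gB v)) (ecc-least covers)) (<⇒≱ fv<gv)
      ...       | inj₂ (w , fw>0 , dvw≡) with gI w (≤-trans fw>0 (f≤g w)) v
                                              (≤-<-trans z≤n fv<gv , subst (_≤ g v) (trans (sym dvw≡) (d-sym v w)) fv<gv)
      ...         | refl = contradiction (trans (sym (d-refl v)) dvw≡) 0≢1+n

-- Distances on the path

absDiff≡∣-∣ : ∀ m n → absDiff m n ≡ ∣ m - n ∣
absDiff≡∣-∣ zero    n       = refl
absDiff≡∣-∣ (suc m) zero    = refl
absDiff≡∣-∣ (suc m) (suc n) = absDiff≡∣-∣ m n

∣-∣≤-intro : ∀ {m n o} → m ≤ n + o → n ≤ m + o → ∣ m - n ∣ ≤ o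
∣-∣≤-intro {m} {n} m≤n+o n≤m+o with ∣m-n∣≡[m∸n]∨[n∸m] m n
... | inj₁ e = subst (_≤ _) (sym e) (m≤n+o⇒m∸n≤o m n m≤n+o)
... | inj₂ e = subst (_≤ _) (sym e) (m≤n+o⇒m∸n≤o n m n≤m+o)

∣-∣≤-elim : ∀ {m n o} → ∣ m - n ∣ ≤ o → m ≤ n + o × n ≤ m + o
∣-∣≤-elim {m} {n} le =
  ≤-trans (m≤n+∣m-n∣ m n) (+-monoʳ-≤ n le) , ≤-trans (m≤n+∣n-m∣ n m) (+-monoʳ-≤ m le)

∣-∣≡suc-elim : ∀ {m n k} → m ≤ n → ∣ n - m ∣ ≡ suc k → n ≡ suc (m + k)
∣-∣≡suc-elim {m} {n} {k} m≤n e = begin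
  n            ≡⟨ m+[n∸m]≡n m≤n ⟨
  m + (n ∸ m)  ≡⟨ cong (m +_) (trans (sym (m≤n⇒∣n-m∣≡n∸m m≤n)) e) ⟩
  m + suc k    ≡⟨ +-suc m k ⟩
  suc (m + k)  ∎
  where open ≡-Reasoning

∣n-k+n∣≡k : ∀ n k → ∣ n - k + n ∣ ≡ k
∣n-k+n∣≡k zero    k = +-identityʳ k
∣n-k+n∣≡k (suc n) k = trans (cong (∣ suc n -_∣) (+-suc k n)) (∣n-k+n∣≡k n k)

∣-∣≤1-cases : ∀ m n → ∣ m - n ∣ ≤ 1 → m ≡ n ⊎ n ≡ suc m ⊎ m ≡ suc n
∣-∣≤1-cases zero          zero          _         = inj₁ refl
∣-∣≤1-cases zero          (suc zero)    _         = inj₂ (inj₁ refl)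
∣-∣≤1-cases (suc zero)    zero          _         = inj₂ (inj₂ refl)
∣-∣≤1-cases zero          (suc (suc n)) (s≤s ())
∣-∣≤1-cases (suc (suc m)) zero          (s≤s ())
∣-∣≤1-cases (suc m)       (suc n)       le with ∣-∣≤1-cases m n le
... | inj₁ m≡n         = inj₁ (cong suc m≡n)
... | inj₂ (inj₁ n≡1+m) = inj₂ (inj₁ (cong suc n≡1+m))
... | inj₂ (inj₂ m≡1+n) = inj₂ (inj₂ (cong suc m≡1+n))

last-below : ∀ {m n} → m < n → m ≤ pred n × suc (pred n) ≡ n
last-below (s≤s m≤n) = m≤n , refl

pathDist-refl : ∀ {n} (v : Fin n) → pathDist n v v ≡ 0
pathDist-refl v = trans (absDiff≡∣-∣ (toℕ v) (toℕ v)) (∣n-n∣≡0 (toℕ v))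

pathDist-sym : ∀ {n} (v w : Fin n) → pathDist n v w ≡ pathDist n w v
pathDist-sym v w = trans (absDiff≡∣-∣ (toℕ v) (toℕ w))
  (trans (∣-∣-comm (toℕ v) (toℕ w)) (sym (absDiff≡∣-∣ (toℕ w) (toℕ v))))

pathDist-far : ∀ {n} → 2 ≤ n → (v : Fin n) → ∃[ w ] 0 < pathDist n v w
pathDist-far (s≤s (s≤s _)) Fin.zero    = Fin.suc Fin.zero , s≤s z≤n
pathDist-far (s≤s (s≤s _)) (Fin.suc v) = Fin.zero , s≤s z≤n

-- Broadcasts on the path as functions on ℕ

Hears : (ℕ → ℕ) → ℕ → ℕ → Set
Hears G u v = 0 < G v × ∣ u - v ∣ ≤ G v

record MaximalOnPath (n : ℕ) (G : ℕ → ℕ) : Set where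
  field
    independent : ∀ {u v} → u < n → v < n → 0 < G u → Hears G u v → u ≡ v
    dominating  : ∀ {u} → u < n → ∃[ v ] v < n × Hears G u v
    saturated   : ∀ {v} → v < n → 0 < G v →
                  (∀ {w} → w < n → ∣ v - w ∣ ≤ G v) ⊎ ∃[ w ] w < n × 0 < G w × ∣ v - w ∣ ≡ suc (G v)

-- Σ_{i<n} G i, unfolded from the left so that blocks-sum below holds by computation.
sumBelow : (ℕ → ℕ) → ℕ → ℕ
sumBelow G zero    = 0
sumBelow G (suc n) = G 0 + sumBelow (G ∘ suc) n

sumBelow-snoc : ∀ G n → sumBelow G (suc n) ≡ sumBelow G n + G n
sumBelow-snoc G zero    = +-comm (G 0) 0
sumBelow-snoc G (suc n) = trans (cong (G 0 +_) (sumBelow-snoc (G ∘ suc) n)) (sym (+-assoc (G 0) _ _))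

sumBelow-zeros : ∀ G {a b} → a ≤ b → (∀ {i} → a ≤ i → i < b → G i ≡ 0) → sumBelow G b ≡ sumBelow G a
sumBelow-zeros G {b = zero}    z≤n   zeros = refl
sumBelow-zeros G {a} {suc b} a≤1+b zeros with m≤n⇒m<n∨m≡n a≤1+b
... | inj₂ refl       = refl
... | inj₁ (s≤s a≤b) = begin
  sumBelow G (suc b)   ≡⟨ sumBelow-snoc G b ⟩
  sumBelow G b + G b   ≡⟨ cong₂ _+_ (sumBelow-zeros G a≤b (λ a≤i → zeros a≤i ∘ m<n⇒m<1+n)) (zeros a≤b ≤-refl) ⟩
  sumBelow G a + 0     ≡⟨ +-identityʳ _ ⟩
  sumBelow G a         ∎
  where open ≡-Reasoning

extend : ∀ {n} → (Fin n → ℕ) → ℕ → ℕ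
extend {zero}  f i       = 0
extend {suc n} f zero    = f Fin.zero
extend {suc n} f (suc i) = extend (f ∘ Fin.suc) i

extend-toℕ : ∀ {n} (f : Fin n → ℕ) x → f x ≡ extend f (toℕ x)
extend-toℕ f Fin.zero    = refl
extend-toℕ f (Fin.suc x) = extend-toℕ (f ∘ Fin.suc) x

extend-vanishes : ∀ {n} (f : Fin n → ℕ) {i} → n ≤ i → extend f i ≡ 0
extend-vanishes {zero}  f         _       = refl
extend-vanishes {suc n} f {suc i} (s≤s p) = extend-vanishes (f ∘ Fin.suc) p

toℕ-onto : ∀ {n i} → i < n → ∃[ x ] toℕ {n} x ≡ i
toℕ-onto i<n = Fin.fromℕ< i<n , toℕ-fromℕ< i<n

module PathTransfer {n : ℕ} (f : Fin n → ℕ) (G : ℕ → ℕ) (f≗G : ∀ x → f x ≡ G (toℕ x)) where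

  private
    d = pathDist n

  pos⇒ : ∀ x → 0 < f x → 0 < G (toℕ x)
  pos⇒ x = subst (0 <_) (f≗G x)

  pos⇐ : ∀ x → 0 < G (toℕ x) → 0 < f x
  pos⇐ x = subst (0 <_) (sym (f≗G x))

  dist≡ : ∀ x y → d x y ≡ ∣ toℕ x - toℕ y ∣
  dist≡ x y = absDiff≡∣-∣ (toℕ x) (toℕ y)

  inH⇒hears : ∀ x y → InH d f x y → Hears G (toℕ x) (toℕ y)
  inH⇒hears x y (fy>0 , dxy≤) = pos⇒ y fy>0 , subst₂ _≤_ (dist≡ x y) (f≗G y) dxy≤

  hears⇒inH : ∀ x y → Hears G (toℕ x) (toℕ y) → InH d f x y
  hears⇒inH x y (Gy>0 , dxy≤) = pos⇐ y Gy>0 , subst₂ _≤_ (sym (dist≡ x y)) (sym (f≗G y)) dxy≤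

  cost≡sumBelow : cost f ≡ sumBelow G n
  cost≡sumBelow = trans (cong sum (map-tabulate (λ x → x) f)) (sum-tabulate f G f≗G)
    where
    sum-tabulate : ∀ {m} (h : Fin m → ℕ) (H : ℕ → ℕ) → (∀ x → h x ≡ H (toℕ x)) →
                   sum (tabulate h) ≡ sumBelow H m
    sum-tabulate {zero}  h H h≗H = refl
    sum-tabulate {suc m} h H h≗H = cong₂ _+_ (h≗H Fin.zero) (sum-tabulate (h ∘ Fin.suc) (H ∘ suc) (h≗H ∘ Fin.suc))

  toMaximalOnPath : IsIndependent d f → Dominating d f → Saturated d f → MaximalOnPath n G
  toMaximalOnPath fI dom sat = record { independent = independent ; dominating = dominating ; saturated = saturated }
    where
    independent : ∀ {u v} → u < n → v < n → 0 < G u → Hears G u v → u ≡ v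
    independent u<n v<n Gu>0 hears with toℕ-onto u<n | toℕ-onto v<n
    ... | x , refl | y , refl = cong toℕ (sym (fI x (pos⇐ x Gu>0) y (hears⇒inH x y hears)))

    dominating : ∀ {u} → u < n → ∃[ v ] v < n × Hears G u v
    dominating u<n with toℕ-onto u<n
    ... | x , refl = let y , x-hears-y = dom x in toℕ y , toℕ<n y , inH⇒hears x y x-hears-y

    saturated : ∀ {v} → v < n → 0 < G v →
                (∀ {w} → w < n → ∣ v - w ∣ ≤ G v) ⊎ ∃[ w ] w < n × 0 < G w × ∣ v - w ∣ ≡ suc (G v)
    saturated v<n Gv>0 with toℕ-onto v<n
    ... | x , refl with sat x (pos⇐ x Gv>0)
    ...   | inj₁ covers = inj₁ λ w<n → covered w<n
      where
      covered : ∀ {w} → w < n → ∣ toℕ x - w ∣ ≤ G (toℕ x)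
      covered w<n with toℕ-onto w<n
      ... | y , refl = subst₂ _≤_ (dist≡ x y) (f≗G x) (covers y)
    ...   | inj₂ (y , fy>0 , dxy≡) =
      inj₂ (toℕ y , toℕ<n y , pos⇒ y fy>0 , trans (sym (dist≡ x y)) (trans dxy≡ (cong suc (f≗G x))))

  fromMaximalOnPath : MaximalOnPath n G → IsIndependent d f × Dominating d f × Saturated d f
  fromMaximalOnPath M = independent , dominating , saturated
    where
    open MaximalOnPath M renaming (independent to indepG; dominating to domG; saturated to satG)

    independent : IsIndependent d f
    independent x fx>0 y x-hears-y =
      toℕ-injective (sym (indepG (toℕ<n x) (toℕ<n y) (pos⇒ x fx>0) (inH⇒hears x y x-hears-y)))

    dominating : Dominating d f
    dominating x with domG (toℕ<n x)
    ... | v , v<n , hears with toℕ-onto v<n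
    ...   | y , refl = y , hears⇒inH x y hears

    saturated : Saturated d f
    saturated x fx>0 with satG (toℕ<n x) (pos⇒ x fx>0)
    ... | inj₁ covers = inj₁ λ y → subst₂ _≤_ (sym (dist≡ x y)) (sym (f≗G x)) (covers (toℕ<n y))
    ... | inj₂ (w , w<n , Gw>0 , dist≡suc) with toℕ-onto w<n
    ...   | y , refl = inj₂ (y , pos⇐ y Gw>0 , trans (dist≡ x y) (trans dist≡suc (cong suc (sym (f≗G x)))))

MaximalOfCost : ℕ → ℕ → Set
MaximalOfCost n k = Σ[ f ∈ (Fin n → ℕ) ] IsMaximalIndepBroadcast (pathDist n) f × cost f ≡ k

maximalOnPath⇒maximal : ∀ {n G} → (∀ x → ∃[ y ] G (toℕ x) ≤ pathDist n x y) → MaximalOnPath n G →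
                        MaximalOfCost n (sumBelow G n)
maximalOnPath⇒maximal {n} {G} reaching M =
  let indep , dom , sat = fromMaximalOnPath M in
  G ∘ toℕ ,
  saturated⇒maximal d pathDist-refl pathDist-sym (isBroadcast-reaching d reaching , indep) dom sat ,
  cost≡sumBelow
  where
  d = pathDist n
  open PathTransfer (G ∘ toℕ) G (λ _ → refl)

maximal⇒maximalOnPath : ∀ {n} {f : Fin n → ℕ} → 2 ≤ n → IsMaximalIndepBroadcast (pathDist n) f →
                        MaximalOnPath n (extend f)
maximal⇒maximalOnPath {n} {f} 2≤n M =
  toMaximalOnPath (proj₂ (proj₁ M))
    (maximal⇒dominating (pathDist n) pathDist-refl pathDist-sym (pathDist-far 2≤n) M)
    (maximal⇒saturated (pathDist n) pathDist-refl pathDist-sym M)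
  where open PathTransfer f (extend f) (extend-toℕ f)

-- The lower bound

module _ where
  open ≡-Reasoning

  first-step-arith : ∀ v b → v ≤ b → 1 ≤ b → 2 * suc (v + b) ≤ 5 * b + 1
  first-step-arith v (suc b) v≤b _ = ≤-trans (*-monoʳ-≤ 2 (s≤s (+-monoˡ-≤ (suc b) v≤b)))
    (m+n≤o⇒m≤o (2 * suc (suc b + suc b)) {b} (≤-reflexive (solve (b ∷ []))))

  tightˡ-step-arith : ∀ u a s b → 2 * suc (u + a) ≤ 5 * s + 1 → 1 ≤ b →
                      2 * suc (suc (u + a) + b) ≤ 5 * (s + b)
  tightˡ-step-arith u a s (suc b) h _ with k , e ← m≤n⇒∃[o]m+o≡n h =
    m+n≤o⇒m≤o _ {k + 3 * b} (≤-reflexive (begin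
      2 * suc (suc (u + a) + suc b) + (k + 3 * b) ≡⟨ solve (u ∷ a ∷ b ∷ k ∷ []) ⟩
      2 * suc (u + a) + k + (5 * b + 4)           ≡⟨ cong (_+ (5 * b + 4)) e ⟩
      5 * s + 1 + (5 * b + 4)                     ≡⟨ solve (s ∷ b ∷ []) ⟩
      5 * (s + suc b)                             ∎))

  tightʳ-step-arith : ∀ u a s b → 2 * suc (u + a) ≤ 5 * s + 1 → 1 ≤ a → 1 ≤ b →
                      2 * suc (suc (u + b) + b) ≤ 5 * (s + b)
  tightʳ-step-arith u (suc a) s (suc b) h _ _ with k , e ← m≤n⇒∃[o]m+o≡n h =
    m+n≤o⇒m≤o _ {k + b + 2 * a} (≤-reflexive (begin
      2 * suc (suc (u + suc b) + suc b) + (k + b + 2 * a) ≡⟨ solve (u ∷ a ∷ b ∷ k ∷ []) ⟩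
      2 * suc (u + suc a) + k + (5 * b + 4)               ≡⟨ cong (_+ (5 * b + 4)) e ⟩
      5 * s + 1 + (5 * b + 4)                             ≡⟨ solve (s ∷ b ∷ []) ⟩
      5 * (s + suc b)                                     ∎))

  loose-step-arith : ∀ u a s v b → 2 * suc (u + a) ≤ 5 * s → v ≤ suc (u + a + b) → 1 ≤ b →
                     2 * suc (v + b) ≤ 5 * (s + b) + 1
  loose-step-arith u a s v (suc b) h v≤ _ with k , e ← m≤n⇒∃[o]m+o≡n h =
    ≤-trans (*-monoʳ-≤ 2 (s≤s (+-monoˡ-≤ (suc b) v≤))) (m+n≤o⇒m≤o _ {k + b} (≤-reflexive (begin
      2 * suc (suc (u + a + suc b) + suc b) + (k + b) ≡⟨ solve (u ∷ a ∷ b ∷ k ∷ []) ⟩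
      2 * suc (u + a) + k + (5 * b + 6)               ≡⟨ cong (_+ (5 * b + 6)) e ⟩
      5 * s + (5 * b + 6)                             ≡⟨ solve (s ∷ b ∷ []) ⟩
      5 * (s + suc b) + 1                             ∎)))

  lone-arith : ∀ n b → 2 ≤ n → n ≢ 3 → 1 ≤ b → n ≤ suc (b + b) → 2 * n ≤ 5 * b
  lone-arith n (suc (suc b)) _ _ _ n≤ = ≤-trans (*-monoʳ-≤ 2 n≤)
    (m+n≤o⇒m≤o (2 * suc (suc (suc b) + suc (suc b))) {b} (≤-reflexive (solve (b ∷ []))))
  lone-arith 2 1 _ _ _ _ = n≤1+n 4
  lone-arith 3 1 _ n≢3 _ _ = contradiction refl n≢3
  lone-arith (suc (suc (suc (suc _)))) 1 _ _ _ (s≤s (s≤s (s≤s ())))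
  lone-arith 1 1 (s≤s ()) _ _ _

ceil2n/5-least : ∀ n s → 2 * n ≤ 5 * s → ceil2n/5 n ≤ s
ceil2n/5-least n s h = s≤s⁻¹ (m<n*o⇒m/o<n (begin-strict
  2 * n + 4  <⟨ +-monoʳ-< (2 * n) (n<1+n 4) ⟩
  2 * n + 5  ≤⟨ +-monoˡ-≤ 5 h ⟩
  5 * s + 5  ≡⟨ solve (s ∷ []) ⟩
  suc s * 5  ∎))
  where open ≤-Reasoning

module _ (G : ℕ → ℕ) where

  Silent : ℕ → ℕ → Set
  Silent u v = ∀ {w} → u < w → w < v → G w ≡ 0

  data Predecessor (v : ℕ) : Set where
    none : (∀ {w} → w < v → G w ≡ 0) → Predecessor v
    just : ∀ {u} → u < v → 0 < G u → Silent u v → Predecessor v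

  zero-below-suc : ∀ {v w} → G v ≡ 0 → (w < v → G w ≡ 0) → w < suc v → G w ≡ 0
  zero-below-suc Gv≡0 below w<1+v with m≤n⇒m<n∨m≡n (s≤s⁻¹ w<1+v)
  ... | inj₁ w<v  = below w<v
  ... | inj₂ refl = Gv≡0

  predecessor : ∀ v → Predecessor v
  predecessor zero = none λ ()
  predecessor (suc v) with 0 <? G v
  ... | yes Gv>0 = just ≤-refl Gv>0 (λ v<w w<1+v → contradiction (s≤s⁻¹ w<1+v) (<⇒≱ v<w))
  ... | no Gv≯0 with predecessor v
  ...   | none zeros           = none (zero-below-suc (n≤0⇒n≡0 (≮⇒≥ Gv≯0)) zeros)
  ...   | just u<v Gu>0 silent = just (m<n⇒m<1+n u<v) Gu>0 (zero-below-suc (n≤0⇒n≡0 (≮⇒≥ Gv≯0)) ∘ silent)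

module LowerBound {n : ℕ} {G : ℕ → ℕ} (vanishes : ∀ {i} → n ≤ i → G i ≡ 0) (M : MaximalOnPath n G) where
  open MaximalOnPath M

  broadcaster<n : ∀ {v} → 0 < G v → v < n
  broadcaster<n Gv>0 = ≰⇒> (λ n≤v → n>0⇒n≢0 Gv>0 (vanishes n≤v))

  hears⇒≡ : ∀ {u v} → 0 < G u → Hears G u v → u ≡ v
  hears⇒≡ Gu>0 hears = independent (broadcaster<n Gu>0) (broadcaster<n (proj₁ hears)) Gu>0 hears

  separated : ∀ {u v} → u < v → 0 < G u → 0 < G v → u + G u < v × u + G v < v
  separated {u} {v} u<v Gu>0 Gv>0 =
      ≰⇒> (λ v≤ → <⇒≢ u<v (sym (hears⇒≡ Gv>0 (Gu>0 , ∣-∣≤-intro v≤ (≤-trans (<⇒≤ u<v) (m≤m+n v _))))))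
    , ≰⇒> (λ v≤ → <⇒≢ u<v (hears⇒≡ Gu>0 (Gv>0 , ∣-∣≤-intro (≤-trans (<⇒≤ u<v) (m≤m+n v _)) v≤)))

  shadowedʳ : ∀ {x v w} → x ≤ v → v < w → 0 < G v → ¬ Hears G x w
  shadowedʳ x≤v v<w Gv>0 hears@(Gw>0 , dist≤) =
    <⇒≱ (proj₂ (separated v<w Gv>0 Gw>0)) (≤-trans (proj₂ (∣-∣≤-elim dist≤)) (+-monoˡ-≤ _ x≤v))

  shadowedˡ : ∀ {x v w} → w < v → v ≤ x → 0 < G v → ¬ Hears G x w
  shadowedˡ w<v v≤x Gv>0 (Gw>0 , dist≤) =
    <⇒≱ (proj₁ (separated w<v Gw>0 Gv>0)) (≤-trans v≤x (proj₁ (∣-∣≤-elim dist≤)))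

  first-reach : ∀ {v} → 0 < G v → (∀ {w} → w < v → G w ≡ 0) → v ≤ G v
  first-reach {v} Gv>0 zeros with dominating (≤-<-trans z≤n (broadcaster<n Gv>0))
  ... | w , _ , hears with <-cmp w v
  ...   | tri< w<v _ _ = contradiction (zeros w<v) (n>0⇒n≢0 (proj₁ hears))
  ...   | tri≈ _ refl _ = proj₂ hears
  ...   | tri> _ _ v<w = contradiction hears (shadowedʳ z≤n v<w Gv>0)

  last-reach : ∀ {v} → 0 < G v → Silent G v n → n ≤ suc (v + G v)
  last-reach {v} Gv>0 silent with last-below (broadcaster<n Gv>0)
  ... | v≤x , 1+x≡n with dominating (≤-reflexive 1+x≡n)
  ...   | w , w<n , hears with <-cmp w v
  ...     | tri< w<v _ _ = contradiction hears (shadowedˡ w<v v≤x Gv>0)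
  ...     | tri≈ _ refl _ = subst (_≤ suc (v + G v)) 1+x≡n (s≤s (proj₁ (∣-∣≤-elim (proj₂ hears))))
  ...     | tri> _ _ v<w = contradiction (silent v<w w<n) (n>0⇒n≢0 (proj₁ hears))

  Tight : ℕ → ℕ → Set
  Tight u v = v ≡ suc (u + G u) ⊎ v ≡ suc (u + G v)

  LeftTight : ℕ → Set
  LeftTight v = ∃[ u ] u < v × 0 < G u × Tight u v

  reach : ℕ → ℕ
  reach v = suc (v + G v)

  ReachBound : ℕ → Set
  ReachBound v = 2 * reach v ≤ 5 * sumBelow G (suc v) + 1 × (LeftTight v → 2 * reach v ≤ 5 * sumBelow G (suc v))

  first-bound : ∀ {v} → 0 < G v → (∀ {w} → w < v → G w ≡ 0) → ReachBound v
  first-bound {v} Gv>0 zeros =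
      subst (λ s → 2 * reach v ≤ 5 * s + 1) (sym sum≡) (first-step-arith v (G v) (first-reach Gv>0 zeros) Gv>0)
    , λ (u , u<v , Gu>0 , _) → contradiction (zeros u<v) (n>0⇒n≢0 Gu>0)
    where
    sum≡ : sumBelow G (suc v) ≡ G v
    sum≡ = trans (sumBelow-snoc G v) (cong (_+ G v) (sumBelow-zeros G z≤n (λ _ → zeros)))

  module Consecutive {u v} (u<v : u < v) (Gu>0 : 0 < G u) (Gv>0 : 0 < G v) (silent : Silent G u v) where

    gap : v ≤ suc (u + G u + G v)
    gap with v ≤? suc (u + G u)
    ... | yes v≤ = ≤-trans v≤ (s≤s (m≤m+n (u + G u) (G v)))
    ... | no v≰ with dominating {suc (u + G u)} (<-trans (≰⇒> v≰) (broadcaster<n Gv>0))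
    ...   | w , _ , hears with <-cmp w u | <-cmp w v
    ...     | tri< w<u _ _ | _ = contradiction hears (shadowedˡ w<u (m≤n⇒m≤1+n (m≤m+n u (G u))) Gu>0)
    ...     | tri≈ _ refl _ | _ = contradiction (proj₁ (∣-∣≤-elim {n = u} (proj₂ hears))) 1+n≰n
    ...     | tri> _ _ u<w | tri< w<v _ _ = contradiction (silent u<w w<v) (n>0⇒n≢0 (proj₁ hears))
    ...     | tri> _ _ _ | tri≈ _ refl _ = proj₂ (∣-∣≤-elim (proj₂ hears))
    ...     | tri> _ _ _ | tri> _ _ v<w = contradiction hears (shadowedʳ (<⇒≤ (≰⇒> v≰)) v<w Gv>0)

    tight-predecessor : LeftTight v → Tight u v
    tight-predecessor (u′ , u′<v , Gu′>0 , tight) with <-cmp u′ u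
    ... | tri≈ _ refl _ = tight
    ... | tri> _ _ u<u′ = contradiction (silent u<u′ u′<v) (n>0⇒n≢0 Gu′>0)
    ... | tri< u′<u _ _ with tight
    ...   | inj₁ v≡ = contradiction (s≤s⁻¹ (subst (u <_) v≡ u<v)) (<⇒≱ (proj₁ (separated u′<u Gu′>0 Gu>0)))
    ...   | inj₂ v≡ =
      contradiction (+-cancelʳ-≤ (G v) u u′ (s≤s⁻¹ (subst (u + G v <_) v≡ (proj₂ (separated u<v Gu>0 Gv>0)))))
                    (<⇒≱ u′<u)

    leftTight-of-loose : ¬ Tight u v → LeftTight u
    leftTight-of-loose loose with saturated (broadcaster<n Gu>0) Gu>0
    ... | inj₁ covers =
      contradiction (hears⇒≡ Gv>0 (Gu>0 , subst (_≤ G u) (∣-∣-comm u v) (covers (broadcaster<n Gv>0)))) (>⇒≢ u<v)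
    ... | inj₂ (w , _ , Gw>0 , dist≡) with <-cmp w u
    ...   | tri< w<u _ _ = w , w<u , Gw>0 , inj₂ (∣-∣≡suc-elim (<⇒≤ w<u) dist≡)
    ...   | tri≈ _ refl _ = contradiction (trans (sym (∣n-n∣≡0 w)) dist≡) 0≢1+n
    ...   | tri> _ _ u<w with ∣-∣≡suc-elim (<⇒≤ u<w) (trans (∣-∣-comm w u) dist≡) | <-cmp w v
    ...     | _  | tri< w<v _ _ = contradiction (silent u<w w<v) (n>0⇒n≢0 Gw>0)
    ...     | w≡ | tri≈ _ refl _ = contradiction (inj₁ w≡) loose
    ...     | w≡ | tri> _ _ v<w =
      contradiction (s≤s⁻¹ (subst (v <_) w≡ v<w)) (<⇒≱ (proj₁ (separated u<v Gu>0 Gv>0)))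

    S : ℕ
    S = sumBelow G (suc u)

    sum≡ : sumBelow G (suc v) ≡ S + G v
    sum≡ = trans (sumBelow-snoc G v) (cong (_+ G v) (sumBelow-zeros G u<v silent))

    strongly : 2 * reach v ≤ 5 * (S + G v) → ReachBound v
    strongly le = ≤-trans le′ (m≤m+n _ 1) , λ _ → le′
      where le′ = subst (λ s → 2 * reach v ≤ 5 * s) (sym sum≡) le

    next-bound : ReachBound u → ReachBound v
    next-bound (weak , strong) with v ≟ suc (u + G u) | v ≟ suc (u + G v)
    ... | yes v≡ | _ = strongly (subst (λ x → 2 * suc (x + G v) ≤ 5 * (S + G v)) (sym v≡)
                                     (tightˡ-step-arith u (G u) S (G v) weak Gv>0))
    ... | no _ | yes v≡ = strongly (subst (λ x → 2 * suc (x + G v) ≤ 5 * (S + G v)) (sym v≡)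
                                          (tightʳ-step-arith u (G u) S (G v) weak Gu>0 Gv>0))
    ... | no ¬tightˡ | no ¬tightʳ =
        subst (λ s → 2 * reach v ≤ 5 * s + 1) (sym sum≡)
          (loose-step-arith u (G u) S v (G v) (strong (leftTight-of-loose loose)) gap Gv>0)
      , λ leftTight → contradiction (tight-predecessor leftTight) loose
      where
      loose : ¬ Tight u v
      loose = [ ¬tightˡ , ¬tightʳ ]

  reachBound : ∀ v → 0 < G v → ReachBound v
  reachBound = <-rec _ step
    where
    step : ∀ v → (∀ {u} → u < v → 0 < G u → ReachBound u) → 0 < G v → ReachBound v
    step v rec Gv>0 with predecessor G v
    ... | none zeros           = first-bound Gv>0 zeros
    ... | just u<v Gu>0 silent = Consecutive.next-bound u<v Gu>0 Gv>0 silent (rec u<v Gu>0)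

  only-broadcaster : ∀ {v} → 0 < G v → (∀ {w} → w < n → ∣ v - w ∣ ≤ G v) → ∀ {w} → w < v → G w ≡ 0
  only-broadcaster {v} Gv>0 covers {w} w<v = n≤0⇒n≡0 (≮⇒≥ λ Gw>0 →
    >⇒≢ w<v (sym (hears⇒≡ Gw>0 (Gv>0 , subst (_≤ G v) (∣-∣-comm v w) (covers (<-trans w<v (broadcaster<n Gv>0)))))))

  last-covering-bound : ∀ {v} → 0 < G v → Silent G v n → (∀ {w} → w < n → ∣ v - w ∣ ≤ G v) →
                        2 ≤ n → n ≢ 3 → 2 * n ≤ 5 * sumBelow G n
  last-covering-bound {v} Gv>0 silent covers 2≤n n≢3 = subst (λ s → 2 * n ≤ 5 * s) (sym sum≡)
    (lone-arith n (G v) 2≤n n≢3 Gv>0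
      (≤-trans (last-reach Gv>0 silent) (s≤s (+-monoˡ-≤ (G v) (first-reach Gv>0 zeros)))))
    where
    v<n = broadcaster<n Gv>0
    zeros = only-broadcaster Gv>0 covers
    sum≡ : sumBelow G n ≡ G v
    sum≡ = trans (sumBelow-zeros G v<n silent)
                 (trans (sumBelow-snoc G v) (cong (_+ G v) (sumBelow-zeros G z≤n (λ _ → zeros))))

  last-leftTight-bound : ∀ {v} → 0 < G v → Silent G v n → LeftTight v → 2 * n ≤ 5 * sumBelow G n
  last-leftTight-bound {v} Gv>0 silent leftTight =
    subst (λ s → 2 * n ≤ 5 * s) (sym (sumBelow-zeros G (broadcaster<n Gv>0) silent))
      (≤-trans (*-monoʳ-≤ 2 (last-reach Gv>0 silent)) (proj₂ (reachBound v Gv>0) leftTight))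

  2n≤5*sumBelow : 2 ≤ n → n ≢ 3 → 2 * n ≤ 5 * sumBelow G n
  2n≤5*sumBelow 2≤n n≢3 with predecessor G n
  ... | none zeros = let w , w<n , Gw>0 , _ = dominating (≤-trans (s≤s z≤n) 2≤n) in
                     contradiction (zeros w<n) (n>0⇒n≢0 Gw>0)
  ... | just {v} v<n Gv>0 silent with saturated v<n Gv>0
  ...   | inj₁ covers = last-covering-bound Gv>0 silent covers 2≤n n≢3
  ...   | inj₂ (w , w<n , Gw>0 , dist≡) with <-cmp w v
  ...     | tri< w<v _ _ = last-leftTight-bound Gv>0 silent (w , w<v , Gw>0 , inj₂ (∣-∣≡suc-elim (<⇒≤ w<v) dist≡))
  ...     | tri≈ _ refl _ = contradiction (trans (sym (∣n-n∣≡0 w)) dist≡) 0≢1+n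
  ...     | tri> _ _ v<w = contradiction (silent v<w w<n) (n>0⇒n≢0 Gw>0)

ceil2n/5-≤-cost : ∀ {n} → 2 ≤ n → n ≢ 3 → ∀ f → IsMaximalIndepBroadcast (pathDist n) f →
                  ceil2n/5 n ≤ cost f
ceil2n/5-≤-cost {n} 2≤n n≢3 f M = subst (ceil2n/5 n ≤_) (sym cost≡sumBelow)
  (ceil2n/5-least n _ (LowerBound.2n≤5*sumBelow (extend-vanishes f) (maximal⇒maximalOnPath 2≤n M) 2≤n n≢3))
  where open PathTransfer f (extend f) (extend-toℕ f)

-- Broadcasts of cost ⌈2n/5⌉

NearOne : (ℕ → ℕ) → ℕ → ℕ → Set
NearOne G N i = G i ≡ 1 ⊎ (suc i < N × G (suc i) ≡ 1) ⊎ ∃[ j ] i ≡ suc j × G j ≡ 1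

OneTwoAway : (ℕ → ℕ) → ℕ → ℕ → Set
OneTwoAway G N i = (suc (suc i) < N × G (suc (suc i)) ≡ 1) ⊎ ∃[ j ] i ≡ suc (suc j) × G j ≡ 1

module _ {N : ℕ} {G : ℕ → ℕ} (≤1 : ∀ i → G i ≤ 1) where

  private
    ≡1 : ∀ {i} → 0 < G i → G i ≡ 1
    ≡1 {i} = ≤-antisym (≤1 i)

    >0 : ∀ {i} → G i ≡ 1 → 0 < G i
    >0 Gi≡1 = ≤-reflexive (sym Gi≡1)

  zeroOne-reaching : 2 ≤ N → ∀ x → ∃[ y ] G (toℕ x) ≤ pathDist N x y
  zeroOne-reaching 2≤N x = let y , d>0 = pathDist-far 2≤N x in y , ≤-trans (≤1 (toℕ x)) d>0

  zeroOne-maximalOnPath : (∀ i → G i ≡ 1 → G (suc i) ≢ 1) → (∀ {i} → i < N → NearOne G N i) →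
                          (∀ {i} → i < N → G i ≡ 1 → OneTwoAway G N i) → MaximalOnPath N G
  zeroOne-maximalOnPath spaced near twoAway = record
    { independent = independent ; dominating = dominating ; saturated = saturated }
    where
    independent : ∀ {u v} → u < N → v < N → 0 < G u → Hears G u v → u ≡ v
    independent {u} {v} _ _ Gu>0 (Gv>0 , dist≤) with ∣-∣≤1-cases u v (≤-trans dist≤ (≤1 v))
    ... | inj₁ u≡v         = u≡v
    ... | inj₂ (inj₁ refl) = contradiction (≡1 Gv>0) (spaced u (≡1 Gu>0))
    ... | inj₂ (inj₂ refl) = contradiction (≡1 Gu>0) (spaced v (≡1 Gv>0))

    dominating : ∀ {u} → u < N → ∃[ v ] v < N × Hears G u v
    dominating {u} u<N with near u<N
    ... | inj₁ Gu≡1                 = u , u<N , >0 Gu≡1 , subst (_≤ G u) (sym (∣n-n∣≡0 u)) z≤n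
    ... | inj₂ (inj₁ (1+u<N , G≡1)) = suc u , 1+u<N , >0 G≡1 , ≤-reflexive (trans (∣n-k+n∣≡k u 1) (sym G≡1))
    ... | inj₂ (inj₂ (j , refl , G≡1)) =
      j , <-trans (n<1+n j) u<N , >0 G≡1 ,
      ≤-reflexive (trans (∣-∣-comm (suc j) j) (trans (∣n-k+n∣≡k j 1) (sym G≡1)))

    saturated : ∀ {v} → v < N → 0 < G v →
                (∀ {w} → w < N → ∣ v - w ∣ ≤ G v) ⊎ ∃[ w ] w < N × 0 < G w × ∣ v - w ∣ ≡ suc (G v)
    saturated {v} v<N Gv>0 with twoAway v<N (≡1 Gv>0)
    ... | inj₁ (2+v<N , G≡1) =
      inj₂ (suc (suc v) , 2+v<N , >0 G≡1 , trans (∣n-k+n∣≡k v 2) (cong suc (sym (≡1 Gv>0))))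
    ... | inj₂ (j , refl , G≡1) = inj₂ (j , <-trans (≤-<-trans (n≤1+n j) (n<1+n (suc j))) v<N , >0 G≡1 ,
      trans (∣-∣-comm (suc (suc j)) j) (trans (∣n-k+n∣≡k j 2) (cong suc (sym (≡1 Gv>0)))))

alternating : ℕ → ℕ
alternating 0             = 0
alternating 1             = 1
alternating (suc (suc i)) = alternating i

blocks : ℕ → ℕ → ℕ
blocks zero    i = alternating i
blocks (suc q) 0 = 0
blocks (suc q) 1 = 1
blocks (suc q) 2 = 0
blocks (suc q) 3 = 1
blocks (suc q) 4 = 0
blocks (suc q) (suc (suc (suc (suc (suc i))))) = blocks q i

alternating-cases : ∀ i → alternating i ≡ 0 × alternating (suc i) ≡ 1
                        ⊎ alternating i ≡ 1 × alternating (suc i) ≡ 0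
alternating-cases 0             = inj₁ (refl , refl)
alternating-cases 1             = inj₂ (refl , refl)
alternating-cases (suc (suc i)) = alternating-cases i

blocks-≤1 : ∀ q i → blocks q i ≤ 1
blocks-≤1 zero i with alternating-cases i
... | inj₁ (a≡0 , _) = subst (_≤ 1) (sym a≡0) z≤n
... | inj₂ (a≡1 , _) = ≤-reflexive a≡1
blocks-≤1 (suc q) 0 = z≤n
blocks-≤1 (suc q) 1 = ≤-refl
blocks-≤1 (suc q) 2 = z≤n
blocks-≤1 (suc q) 3 = ≤-refl
blocks-≤1 (suc q) 4 = z≤n
blocks-≤1 (suc q) (suc (suc (suc (suc (suc i))))) = blocks-≤1 q i

blocks-spaced : ∀ q i → blocks q i ≡ 1 → blocks q (suc i) ≢ 1
blocks-spaced zero i a≡1 a′≡1 with alternating-cases i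
... | inj₁ (a≡0 , _)  = 0≢1+n (trans (sym a≡0) a≡1)
... | inj₂ (_ , a′≡0) = 0≢1+n (trans (sym a′≡0) a′≡1)
blocks-spaced (suc q) 0 ()
blocks-spaced (suc q) 1 _ ()
blocks-spaced (suc q) 2 ()
blocks-spaced (suc q) 3 _ ()
blocks-spaced (suc q) 4 ()
blocks-spaced (suc q) (suc (suc (suc (suc (suc i))))) = blocks-spaced q i

blocks-near : ∀ q {m} → 4 ≤ m → ∀ {i} → i < q * 5 + m → NearOne (blocks q) (q * 5 + m) i
blocks-near zero 4≤m {i} i<m with alternating-cases i
... | inj₂ (a≡1 , _) = inj₁ a≡1
blocks-near zero 4≤m {zero}  _ | inj₁ (_ , a′≡1) = inj₂ (inj₁ (≤-trans (s≤s (s≤s z≤n)) 4≤m , a′≡1))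
blocks-near zero 4≤m {suc j} _ | inj₁ (_ , a′≡1) = inj₂ (inj₂ (j , refl , a′≡1))
blocks-near (suc q) _ {0} _ = inj₂ (inj₁ (s≤s (s≤s z≤n) , refl))
blocks-near (suc q) _ {1} _ = inj₁ refl
blocks-near (suc q) _ {2} _ = inj₂ (inj₂ (1 , refl , refl))
blocks-near (suc q) _ {3} _ = inj₁ refl
blocks-near (suc q) _ {4} _ = inj₂ (inj₂ (3 , refl , refl))
blocks-near (suc q) 4≤m {suc (suc (suc (suc (suc i))))} i<N with blocks-near q 4≤m (+-cancelˡ-< 5 _ _ i<N)
... | inj₁ G≡1                     = inj₁ G≡1
... | inj₂ (inj₁ (1+i<N , G≡1))     = inj₂ (inj₁ (+-monoʳ-< 5 1+i<N , G≡1))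
... | inj₂ (inj₂ (j , refl , G≡1)) = inj₂ (inj₂ (5 + j , refl , G≡1))

blocks-twoAway : ∀ q {m} → 4 ≤ m → ∀ {i} → i < q * 5 + m → blocks q i ≡ 1 →
                 OneTwoAway (blocks q) (q * 5 + m) i
blocks-twoAway zero {m} 4≤m {i} _ a≡1 with suc (suc i) <? m
... | yes 2+i<m = inj₁ (2+i<m , a≡1)
blocks-twoAway zero 4≤m {1}           _ _   | no 2+i≮m = contradiction 4≤m 2+i≮m
blocks-twoAway zero 4≤m {suc (suc j)} _ a≡1 | no _     = inj₂ (j , refl , a≡1)
blocks-twoAway (suc q) _ {1} _ _ = inj₁ (s≤s (s≤s (s≤s (s≤s z≤n))) , refl)
blocks-twoAway (suc q) _ {3} _ _ = inj₂ (1 , refl , refl)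
blocks-twoAway (suc q) 4≤m {suc (suc (suc (suc (suc i))))} i<N G≡1
  with blocks-twoAway q 4≤m (+-cancelˡ-< 5 _ _ i<N) G≡1
... | inj₁ (2+i<N , G′≡1)    = inj₁ (+-monoʳ-< 5 2+i<N , G′≡1)
... | inj₂ (j , refl , G′≡1) = inj₂ (5 + j , refl , G′≡1)

blocks-sum : ∀ q m → sumBelow (blocks q) (q * 5 + m) ≡ q * 2 + sumBelow alternating m
blocks-sum zero    m = refl
blocks-sum (suc q) m = cong (2 +_) (blocks-sum q m)

data TailLength : ℕ → Set where
  len4 : TailLength 4
  len5 : TailLength 5
  len6 : TailLength 6
  len7 : TailLength 7
  len8 : TailLength 8

tailLength-≥4 : ∀ {m} → TailLength m → 4 ≤ m
tailLength-≥4 len4 = m≤m+n 4 0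
tailLength-≥4 len5 = m≤m+n 4 1
tailLength-≥4 len6 = m≤m+n 4 2
tailLength-≥4 len7 = m≤m+n 4 3
tailLength-≥4 len8 = m≤m+n 4 4

tailLength-ceil : ∀ {m} → TailLength m → ceil2n/5 m ≡ sumBelow alternating m
tailLength-ceil len4 = refl
tailLength-ceil len5 = refl
tailLength-ceil len6 = refl
tailLength-ceil len7 = refl
tailLength-ceil len8 = refl

split-5q+tail : ∀ n → 4 ≤ n → ∃[ q ] ∃[ m ] TailLength m × n ≡ q * 5 + m
split-5q+tail 4 _ = 0 , 4 , len4 , refl
split-5q+tail 5 _ = 0 , 5 , len5 , refl
split-5q+tail 6 _ = 0 , 6 , len6 , refl
split-5q+tail 7 _ = 0 , 7 , len7 , refl
split-5q+tail 8 _ = 0 , 8 , len8 , refl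
split-5q+tail (suc (suc (suc (suc (suc n@(suc (suc (suc (suc _))))))))) _
  with q , m , tail , n≡ ← split-5q+tail n (m≤m+n 4 _) = suc q , m , tail , cong (5 +_) n≡
split-5q+tail 1 (s≤s ())
split-5q+tail 2 (s≤s (s≤s ()))
split-5q+tail 3 (s≤s (s≤s (s≤s ())))

ceil2n/5-5q+ : ∀ q m → ceil2n/5 (q * 5 + m) ≡ q * 2 + ceil2n/5 m
ceil2n/5-5q+ q m = begin
  (2 * (q * 5 + m) + 4) / 5        ≡⟨ cong (_/ 5) rearrange ⟩
  (2 * m + 4 + q * 2 * 5) / 5      ≡⟨ +-distrib-/-∣ʳ (2 * m + 4) (divides-refl (q * 2)) ⟩
  (2 * m + 4) / 5 + q * 2 * 5 / 5  ≡⟨ cong (ceil2n/5 m +_) (m*n/n≡m (q * 2) 5) ⟩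
  ceil2n/5 m + q * 2               ≡⟨ +-comm (ceil2n/5 m) (q * 2) ⟩
  q * 2 + ceil2n/5 m               ∎
  where
  open ≡-Reasoning
  rearrange : 2 * (q * 5 + m) + 4 ≡ 2 * m + 4 + q * 2 * 5
  rearrange = solve (q ∷ m ∷ [])

blocks-maximal : ∀ q {m} → TailLength m → MaximalOfCost (q * 5 + m) (ceil2n/5 (q * 5 + m))
blocks-maximal q {m} tail =
  let f , M , cost≡ = maximalOnPath⇒maximal (zeroOne-reaching (blocks-≤1 q) 2≤N)
        (zeroOne-maximalOnPath (blocks-≤1 q) (blocks-spaced q) (blocks-near q 4≤m) (blocks-twoAway q 4≤m))
  in f , M , trans cost≡ sum≡ceil
  where
  4≤m = tailLength-≥4 tail
  2≤N = ≤-trans (m≤m+n 2 2) (≤-trans 4≤m (m≤n+m m (q * 5)))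

  sum≡ceil : sumBelow (blocks q) (q * 5 + m) ≡ ceil2n/5 (q * 5 + m)
  sum≡ceil = begin
    sumBelow (blocks q) (q * 5 + m) ≡⟨ blocks-sum q m ⟩
    q * 2 + sumBelow alternating m  ≡⟨ cong (q * 2 +_) (tailLength-ceil tail) ⟨
    q * 2 + ceil2n/5 m              ≡⟨ ceil2n/5-5q+ q m ⟨
    ceil2n/5 (q * 5 + m)            ∎
    where open ≡-Reasoning

single : ℕ → ℕ
single zero    = 1
single (suc _) = 0

single-≤1 : ∀ i → single i ≤ 1
single-≤1 zero    = ≤-refl
single-≤1 (suc _) = z≤n

single-maximalOnPath₂ : MaximalOnPath 2 single
single-maximalOnPath₂ = record { independent = independent ; dominating = dominating ; saturated = saturated }
  where
  independent : ∀ {u v} → u < 2 → v < 2 → 0 < single u → Hears single u v → u ≡ v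
  independent {zero} {zero} _ _ _ _ = refl

  dominating : ∀ {u} → u < 2 → ∃[ v ] v < 2 × Hears single u v
  dominating {0} _ = 0 , s≤s z≤n , ≤-refl , z≤n
  dominating {1} _ = 0 , s≤s z≤n , ≤-refl , ≤-refl
  dominating {suc (suc _)} (s≤s (s≤s ()))

  saturated : ∀ {v} → v < 2 → 0 < single v →
              (∀ {w} → w < 2 → ∣ v - w ∣ ≤ single v) ⊎ ∃[ w ] w < 2 × 0 < single w × ∣ v - w ∣ ≡ suc (single v)
  saturated {zero} _ _ = inj₁ λ { {0} _ → z≤n ; {1} _ → ≤-refl ; {suc (suc _)} (s≤s (s≤s ())) }

ceil2n/5-attained : ∀ n → 2 ≤ n → n ≢ 3 → MaximalOfCost n (ceil2n/5 n)
ceil2n/5-attained 1 (s≤s ()) _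
ceil2n/5-attained 2 _ _ = maximalOnPath⇒maximal (zeroOne-reaching single-≤1 ≤-refl) single-maximalOnPath₂
ceil2n/5-attained 3 _ n≢3 = contradiction refl n≢3
ceil2n/5-attained n@(suc (suc (suc (suc _)))) _ _ with q , m , tail , n≡ ← split-5q+tail n (m≤m+n 4 _) =
  subst (λ n → MaximalOfCost n (ceil2n/5 n)) (sym n≡) (blocks-maximal q tail)

theorem3p7 : (n : ℕ) → 2 ≤ n → n ≢ 3 → IbEq (pathDist n) (ceil2n/5 n)
theorem3p7 n 2≤n n≢3 = ceil2n/5-attained n 2≤n n≢3 , ceil2n/5-≤-cost 2≤n n≢3
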